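{- Let $G$ be a connected, non-complete finite simple graph such that $G=H^2$ for some graph $H$. (i) If $\mathrm{girth}(H)\ge 6$ and $v$ is a vertex with $\deg_H(v)\ge 2$, then $N_H[v]$ is a maximal clique in $G$. (ii) If $\mathrm{girth}(H)\ge 7$ and $Q$ is a maximal clique in $G$, then $Q=N_H[v]$ for some vertex $v$ with $\deg_H(v)\ge 2$.
   Context: All graphs are finite, undirected and simple. For a graph $H$, $H^2$ is the graph on the same vertex set in which two distinct vertices are adjacent iff their distance in $H$ is at most $2$. $N_H(v)$ is the set of neighbours of $v$ in $H$, $N_H[v]=N_H(v)\cup\{v\}$, and $\deg_H(v)=|N_H(v)|$. The girth of a graph is the length of a shortest cycle ($\infty$ if the graph is acyclic). A clique is a set of pairwise adjacent vertices; a maximal clique is one not properly contained in another clique. -}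

module Defs where

open import Data.Nat using (ℕ; zero; suc; _≤_)
open import Data.Fin using (Fin; zero; suc; inject₁; fromℕ)
open import Data.Fin.Properties using (any?; _≟_)
open import Data.Fin.Subset using (Subset; _∈_; _⊆_; _∪_; ⁅_⁆; ∣_∣)
open import Data.Vec using (tabulate)
open import Data.Product using (Σ; ∃; _×_; _,_; proj₁; proj₂)
open import Data.Sum using (_⊎_; inj₁; inj₂)
open import Relation.Nullary using (¬_; Dec; yes; no; does)
open import Relation.Nullary.Decidable using (_×-dec_; _⊎-dec_; ¬?)
open import Relation.Binary.PropositionalEquality using (_≡_; _≢_)
open import Function.Definitions using (Injective)

record Graph (n : ℕ) : Set₁ where
  field
    Adj    : Fin n → Fin n → Set
    sym    : ∀ {u v} → Adj u v → Adj v u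
    irrefl : ∀ {v} → ¬ Adj v v
    adj?   : ∀ u v → Dec (Adj u v)
open Graph public

Adj² : ∀ {n} → Graph n → Fin n → Fin n → Set
Adj² H u v = u ≢ v × (Adj H u v ⊎ ∃ λ w → Adj H u w × Adj H w v)

square : ∀ {n} → Graph n → Graph n
square H = record
  { Adj = Adj² H
  ; sym = λ { (ne , inj₁ a) → (λ e → ne (symm e)) , inj₁ (Graph.sym H a)
            ; (ne , inj₂ (w , a , b)) → (λ e → ne (symm e)) , inj₂ (w , Graph.sym H b , Graph.sym H a) }
  ; irrefl = λ p → proj₁ p _≡_.refl
  ; adj? = λ u v → ¬? (u ≟ v) ×-dec (adj? H u v ⊎-dec any? (λ w → adj? H u w ×-dec adj? H w v))
  }
  where
  symm : ∀ {A : Set} {x y : A} → x ≡ y → y ≡ x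
  symm _≡_.refl = _≡_.refl

N : ∀ {n} → Graph n → Fin n → Subset n
N H v = tabulate (λ u → does (adj? H v u))

N[_,_] : ∀ {n} → Graph n → Fin n → Subset n
N[ H , v ] = ⁅ v ⁆ ∪ N H v

deg : ∀ {n} → Graph n → Fin n → ℕ
deg H v = ∣ N H v ∣

data Walk {n} (G : Graph n) : Fin n → Fin n → Set where
  [] : ∀ {v} → Walk G v v
  _∷_ : ∀ {u w v} → Adj G u w → Walk G w v → Walk G u v

Connected : ∀ {n} → Graph n → Set
Connected {n} G = ∀ (u v : Fin n) → Walk G u v

Complete : ∀ {n} → Graph n → Set
Complete {n} G = ∀ (u v : Fin n) → u ≢ v → Adj G u v

-- A cycle of length k = 3 + m: injective f : Fin k → V with
-- f i ~ f (i+1) and f (k-1) ~ f 0.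
HasCycleOfLength : ∀ {n} → Graph n → ℕ → Set
HasCycleOfLength {n} G zero = Data.Empty.⊥ where import Data.Empty
HasCycleOfLength {n} G (suc zero) = Data.Empty.⊥ where import Data.Empty
HasCycleOfLength {n} G (suc (suc zero)) = Data.Empty.⊥ where import Data.Empty
HasCycleOfLength {n} G (suc (suc (suc m))) =
  Σ (Fin (suc (suc (suc m))) → Fin n) λ f →
    Injective _≡_ _≡_ f
    × (∀ (i : Fin (suc (suc m))) → Adj G (f (inject₁ i)) (f (suc i)))
    × Adj G (f (fromℕ (suc (suc m)))) (f zero)

-- girth(G) ≥ g : every cycle has length ≥ g (vacuous for acyclic graphs, girth = ∞).
GirthAtLeast : ∀ {n} → Graph n → ℕ → Set
GirthAtLeast G g = ∀ k → HasCycleOfLength G k → g ≤ k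

IsClique : ∀ {n} → Graph n → Subset n → Set
IsClique G Q = ∀ u v → u ∈ Q → v ∈ Q → u ≢ v → Adj G u v

IsMaximalClique : ∀ {n} → Graph n → Subset n → Set
IsMaximalClique {n} G Q =
  IsClique G Q × (∀ (Q' : Subset n) → IsClique G Q' → Q ⊆ Q' → Q' ⊆ Q)

-- Everything reduces to excluding short cycles in H.
-- (i) A vertex x ∉ N[v] that is H²-adjacent to v reaches v through a neighbour
-- a; if x were also H²-adjacent to a second neighbour b of v, the path
-- x – a – v – b and the at most two steps from b back to x would contain a
-- cycle of length at most 5.
-- (ii) Given x in a clique Q of H², either Q ⊆ N[x], or Q contains y at
-- distance exactly 2 from x through a middle vertex m, and then any z ∈ Q
-- outside N[m] would close a cycle of length at most 6 through x, m, y and z.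
-- So Q ⊆ N[v] for some v, and it remains to move v to a vertex of degree ≥ 2:
-- if v has a single neighbour u then N[v] ⊆ N[u]; if v is isolated, or both v
-- and u have degree ≤ 1, connectivity of H² forces H² to be complete.
-- Maximality then turns Q ⊆ N[v] into Q = N[v].
module Submission where

open import Defs hiding (sym)
open import Data.Bool using (true)
open import Data.Empty using (⊥; ⊥-elim)
open import Data.Fin using (Fin; zero; suc; inject₁; fromℕ)
open import Data.Fin.Properties using (_≟_; any?)
open import Data.Fin.Subset using (Subset; _∈_; _∉_; _⊆_; ⁅_⁆; ∣_∣)
open import Data.Fin.Subset.Properties
  using (_∈?_; x∈⁅x⁆; x∈⁅y⁆⇒x≡y; ∣⁅x⁆∣≡1; p⊆q⇒∣p∣≤∣q∣; x∈p∪q⁺; x∈p∪q⁻;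
         x∈p∧x≢y⇒x∈p-y; x∈p⇒∣p-x∣<∣p∣; ⊆-antisym)
open import Data.Nat using (ℕ; zero; suc; _≤_; _+_; s≤s; _≤?_; _<?_)
open import Data.Nat.Properties using (≤-trans; <⇒≱)
open import Data.Product using (Σ; ∃; _×_; _,_; proj₁)
open import Data.Sum using (_⊎_; inj₁; inj₂)
open import Data.Vec using (Vec; []; _∷_; lookup; head; last)
open import Data.Vec.Properties using (lookup∘tabulate; []=⇒lookup; lookup⇒[]=)
open import Data.Vec.Relation.Unary.All using ([]; _∷_)
open import Data.Vec.Relation.Unary.AllPairs using ([]; _∷_)
open import Data.Vec.Relation.Unary.Linked using (Linked; []; [-]; _∷_)
open import Data.Vec.Relation.Unary.Unique.Propositional using (Unique)
open import Data.Vec.Relation.Unary.Unique.Propositional.Properties using (lookup-injective)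
open import Function using (_∘_)
open import Relation.Nullary using (¬_; yes; no; does; proof; contradiction)
open import Relation.Nullary.Reflects using (Reflects; invert)
open import Relation.Nullary.Decidable using (True; toWitness; dec-true; _×-dec_; ¬?)
open import Relation.Binary.PropositionalEquality
  using (_≡_; _≢_; refl; sym; trans; subst; ≢-sym)

x∈p⇒1≤∣p∣ : ∀ {n} {p : Subset n} {x} → x ∈ p → 1 ≤ ∣ p ∣
x∈p⇒1≤∣p∣ {p = p} {x} x∈p = subst (_≤ ∣ p ∣) (∣⁅x⁆∣≡1 x) (p⊆q⇒∣p∣≤∣q∣ ⁅x⁆⊆p)
  where
  ⁅x⁆⊆p : ⁅ x ⁆ ⊆ p
  ⁅x⁆⊆p y∈⁅x⁆ = subst (_∈ p) (sym (x∈⁅y⁆⇒x≡y x y∈⁅x⁆)) x∈p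

x∈p∧y∈p∧y≢x⇒2≤∣p∣ : ∀ {n} {p : Subset n} {x y} → x ∈ p → y ∈ p → y ≢ x → 2 ≤ ∣ p ∣
x∈p∧y∈p∧y≢x⇒2≤∣p∣ x∈p y∈p y≢x = ≤-trans (s≤s (x∈p⇒1≤∣p∣ (x∈p∧x≢y⇒x∈p-y y∈p y≢x))) (x∈p⇒∣p-x∣<∣p∣ x∈p)

2≤∣p∣⇒∃x∈p∧x≢y : ∀ {n} (p : Subset n) → 2 ≤ ∣ p ∣ → ∀ y → ∃ λ x → x ∈ p × x ≢ y
2≤∣p∣⇒∃x∈p∧x≢y p 2≤∣p∣ y with any? (λ x → x ∈? p ×-dec ¬? (x ≟ y))
... | yes found = found
... | no none = contradiction (subst (∣ p ∣ ≤_) (∣⁅x⁆∣≡1 y) (p⊆q⇒∣p∣≤∣q∣ p⊆⁅y⁆)) (<⇒≱ 2≤∣p∣)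
  where
  p⊆⁅y⁆ : p ⊆ ⁅ y ⁆
  p⊆⁅y⁆ {x} x∈p with x ≟ y
  ... | yes refl = x∈⁅x⁆ y
  ... | no x≢y = contradiction (x , x∈p , x≢y) none

lookup-linked : ∀ {a ℓ} {A : Set a} {R : A → A → Set ℓ} {k} {xs : Vec A (suc k)} →
                Linked R xs → ∀ i → R (lookup xs (inject₁ i)) (lookup xs (suc i))
lookup-linked {xs = _ ∷ _ ∷ _} (r ∷ _) zero = r
lookup-linked {xs = _ ∷ _ ∷ _} (_ ∷ rs) (suc i) = lookup-linked rs i

lookup-fromℕ : ∀ {a} {A : Set a} {k} (xs : Vec A (suc k)) → lookup xs (fromℕ k) ≡ last xs
lookup-fromℕ (x ∷ []) = refl
lookup-fromℕ (x ∷ y ∷ ys) = lookup-fromℕ (y ∷ ys)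

maximal⊆clique⇒≡ : ∀ {n} (G : Graph n) {Q C : Subset n} →
                   IsMaximalClique G Q → IsClique G C → Q ⊆ C → Q ≡ C
maximal⊆clique⇒≡ G (_ , maximal) C-clique Q⊆C = ⊆-antisym Q⊆C (maximal _ C-clique Q⊆C)

maximal-clique-nonempty : ∀ {n} (G : Graph n) {Q : Subset n} →
                          IsMaximalClique G Q → Fin n → ∃ (_∈ Q)
maximal-clique-nonempty G {Q} maximal v with any? (_∈? Q)
... | yes found = found
... | no empty = v , subst (v ∈_) (sym (maximal⊆clique⇒≡ G maximal ⁅v⁆-clique Q⊆⁅v⁆)) (x∈⁅x⁆ v)
  where
  ⁅v⁆-clique : IsClique G ⁅ v ⁆
  ⁅v⁆-clique x y x∈ y∈ x≢y = contradiction (trans (x∈⁅y⁆⇒x≡y v x∈) (sym (x∈⁅y⁆⇒x≡y v y∈))) x≢y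
  Q⊆⁅v⁆ : Q ⊆ ⁅ v ⁆
  Q⊆⁅v⁆ {x} x∈Q = contradiction (x , x∈Q) empty

¬Complete⇒vertex : ∀ {n} (G : Graph n) → ¬ Complete G → Fin n
¬Complete⇒vertex {zero} G incomplete = ⊥-elim (incomplete (λ ()))
¬Complete⇒vertex {suc n} G _ = zero

module _ {n : ℕ} (H : Graph n) where

  private
    G : Graph n
    G = square H

  adj⇒≢ : ∀ {u v} → Adj H u v → u ≢ v
  adj⇒≢ u~v refl = irrefl H u~v

  adj-sym : ∀ {u v} → Adj H u v → Adj H v u
  adj-sym = Graph.sym H

  adj⇒∈N : ∀ {v u} → Adj H v u → u ∈ N H v
  adj⇒∈N {v} {u} v~u =
    lookup⇒[]= u (N H v) (trans (lookup∘tabulate (does ∘ adj? H v) u) (dec-true (adj? H v u) v~u))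

  ∈N⇒adj : ∀ {v u} → u ∈ N H v → Adj H v u
  ∈N⇒adj {v} {u} u∈N = invert (subst (Reflects (Adj H v u)) does≡true (proof (adj? H v u)))
    where
    does≡true : does (adj? H v u) ≡ true
    does≡true = trans (sym (lookup∘tabulate (does ∘ adj? H v) u)) ([]=⇒lookup u∈N)

  ∈N[]⁺ : ∀ {v u} → u ≡ v ⊎ Adj H v u → u ∈ N[ H , v ]
  ∈N[]⁺ {v} (inj₁ refl) = x∈p∪q⁺ (inj₁ (x∈⁅x⁆ v))
  ∈N[]⁺ (inj₂ v~u) = x∈p∪q⁺ (inj₂ (adj⇒∈N v~u))

  ∈N[]⁻ : ∀ {v u} → u ∈ N[ H , v ] → u ≡ v ⊎ Adj H v u
  ∈N[]⁻ {v} u∈N[v] with x∈p∪q⁻ ⁅ v ⁆ (N H v) u∈N[v]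
  ... | inj₁ u∈⁅v⁆ = inj₁ (x∈⁅y⁆⇒x≡y v u∈⁅v⁆)
  ... | inj₂ u∈N = inj₂ (∈N⇒adj u∈N)

  ∉N[]⇒≢ : ∀ {v u} → u ∉ N[ H , v ] → u ≢ v
  ∉N[]⇒≢ u∉ = u∉ ∘ ∈N[]⁺ ∘ inj₁

  ∉N[]⇒¬adj : ∀ {v u} → u ∉ N[ H , v ] → ¬ Adj H v u
  ∉N[]⇒¬adj u∉ = u∉ ∘ ∈N[]⁺ ∘ inj₂

  deg<2⇒neighbour-unique : ∀ {v a b} → ¬ 2 ≤ deg H v → Adj H v a → Adj H v b → a ≡ b
  deg<2⇒neighbour-unique {a = a} {b} deg<2 v~a v~b with a ≟ b
  ... | yes a≡b = a≡b
  ... | no a≢b = contradiction (x∈p∧y∈p∧y≢x⇒2≤∣p∣ (adj⇒∈N v~b) (adj⇒∈N v~a) a≢b) deg<2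

  closed-path⇒cycle : ∀ {m} (vs : Vec (Fin n) (3 + m)) → Unique vs → Linked (Adj H) vs →
          Adj H (last vs) (head vs) → HasCycleOfLength H (3 + m)
  closed-path⇒cycle vs@(v ∷ _) distinct path closing =
    lookup vs , lookup-injective distinct _ _ , lookup-linked path ,
    subst (λ u → Adj H u v) (sym (lookup-fromℕ vs)) closing

  -- The bound 3 + m < g is an implicit unit, discharged by evaluation at numerals.
  girth⇒no-short-cycle : ∀ {g m} → GirthAtLeast H g → {_ : True (3 + m <? g)} →
                         (vs : Vec (Fin n) (3 + m)) → Unique vs → Linked (Adj H) vs →
                         ¬ Adj H (last vs) (head vs)
  girth⇒no-short-cycle {m = m} girth {short} vs distinct path closing =
    <⇒≱ (toWitness short) (girth (3 + m) (closed-path⇒cycle vs distinct path closing))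

  N[]-isClique : ∀ v → IsClique G N[ H , v ]
  N[]-isClique v x y x∈ y∈ x≢y with ∈N[]⁻ x∈ | ∈N[]⁻ y∈
  ... | inj₁ refl | inj₁ refl = contradiction refl x≢y
  ... | inj₁ refl | inj₂ v~y = x≢y , inj₁ v~y
  ... | inj₂ v~x | inj₁ refl = x≢y , inj₁ (adj-sym v~x)
  ... | inj₂ v~x | inj₂ v~y = x≢y , inj₂ (v , adj-sym v~x , v~y)

  ¬adj²-second-neighbour : GirthAtLeast H 6 → ∀ {x a v b} → x ∉ N[ H , v ] →
                           Adj H x a → Adj H a v → Adj H v b → b ≢ a → ¬ Adj² H x b
  ¬adj²-second-neighbour girth {x} {a} {v} {b} x∉N[v] x~a a~v v~b b≢a = closes-cycle
    where
    x≢v : x ≢ v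
    x≢v = ∉N[]⇒≢ x∉N[v]
    x≢b : x ≢ b
    x≢b refl = ∉N[]⇒¬adj x∉N[v] v~b
    closes-cycle : ¬ Adj² H x b
    closes-cycle (_ , inj₁ x~b) = girth⇒no-short-cycle girth (x ∷ a ∷ v ∷ b ∷ [])
      ((adj⇒≢ x~a ∷ x≢v ∷ x≢b ∷ []) ∷ (adj⇒≢ a~v ∷ ≢-sym b≢a ∷ []) ∷ (adj⇒≢ v~b ∷ []) ∷ [] ∷ [])
      (x~a ∷ a~v ∷ v~b ∷ [-]) (adj-sym x~b)
    closes-cycle (_ , inj₂ (c , x~c , c~b)) with c ≟ a | c ≟ v
    ... | yes refl | _ = girth⇒no-short-cycle girth (a ∷ v ∷ b ∷ [])
      ((adj⇒≢ a~v ∷ ≢-sym b≢a ∷ []) ∷ (adj⇒≢ v~b ∷ []) ∷ [] ∷ [])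
      (a~v ∷ v~b ∷ [-]) (adj-sym c~b)
    ... | no _ | yes refl = ∉N[]⇒¬adj x∉N[v] (adj-sym x~c)
    ... | no c≢a | no c≢v = girth⇒no-short-cycle girth (x ∷ a ∷ v ∷ b ∷ c ∷ [])
      ((adj⇒≢ x~a ∷ x≢v ∷ x≢b ∷ adj⇒≢ x~c ∷ []) ∷ (adj⇒≢ a~v ∷ ≢-sym b≢a ∷ ≢-sym c≢a ∷ []) ∷
       (adj⇒≢ v~b ∷ ≢-sym c≢v ∷ []) ∷ (≢-sym (adj⇒≢ c~b) ∷ []) ∷ [] ∷ [])
      (x~a ∷ a~v ∷ v~b ∷ adj-sym c~b ∷ [-]) (adj-sym x~c)

  N[]-isMaximalClique : GirthAtLeast H 6 → ∀ v → 2 ≤ deg H v → IsMaximalClique G N[ H , v ]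
  N[]-isMaximalClique girth v 2≤deg = N[]-isClique v , maximal
    where
    maximal : ∀ Q → IsClique G Q → N[ H , v ] ⊆ Q → Q ⊆ N[ H , v ]
    maximal Q clique N[v]⊆Q {x} x∈Q with x ∈? N[ H , v ]
    ... | yes x∈N[v] = x∈N[v]
    ... | no x∉N[v] with clique x v x∈Q (N[v]⊆Q (∈N[]⁺ (inj₁ refl))) (∉N[]⇒≢ x∉N[v])
    ...   | _ , inj₁ x~v = contradiction (adj-sym x~v) (∉N[]⇒¬adj x∉N[v])
    ...   | _ , inj₂ (a , x~a , a~v) with 2≤∣p∣⇒∃x∈p∧x≢y (N H v) 2≤deg a
    ...     | b , b∈N , b≢a = contradiction
              (clique x b x∈Q (N[v]⊆Q (∈N[]⁺ (inj₂ v~b))) x≢b)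
              (¬adj²-second-neighbour girth x∉N[v] x~a a~v v~b b≢a)
      where
      v~b : Adj H v b
      v~b = ∈N⇒adj b∈N
      x≢b : x ≢ b
      x≢b refl = ∉N[]⇒¬adj x∉N[v] v~b

  ¬adj²-to-both-ends : GirthAtLeast H 7 → ∀ {x m y z} → y ∉ N[ H , x ] → Adj H x m → Adj H m y →
                       z ∉ N[ H , m ] → Adj² H z x → Adj² H y z → ⊥
  ¬adj²-to-both-ends girth {x} {m} {y} {z} y∉N[x] x~m m~y z∉N[m] = closes-cycle
    where
    x≢y : x ≢ y
    x≢y = ≢-sym (∉N[]⇒≢ y∉N[x])
    x≢z : x ≢ z
    x≢z refl = ∉N[]⇒¬adj z∉N[m] (adj-sym x~m)
    y≢z : y ≢ z
    y≢z refl = ∉N[]⇒¬adj z∉N[m] m~y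
    m≢z : m ≢ z
    m≢z = ≢-sym (∉N[]⇒≢ z∉N[m])
    m≢nbr-z : ∀ {w} → Adj H w z → m ≢ w
    m≢nbr-z w~z refl = ∉N[]⇒¬adj z∉N[m] w~z
    y≢nbr-x : ∀ {w} → Adj H w x → y ≢ w
    y≢nbr-x w~x refl = ∉N[]⇒¬adj y∉N[x] (adj-sym w~x)
    x≢nbr-y : ∀ {w} → Adj H y w → x ≢ w
    x≢nbr-y y~w refl = ∉N[]⇒¬adj y∉N[x] (adj-sym y~w)
    closes-cycle : Adj² H z x → Adj² H y z → ⊥
    closes-cycle (_ , inj₁ z~x) (_ , inj₁ y~z) = girth⇒no-short-cycle girth (x ∷ m ∷ y ∷ z ∷ [])
      ((adj⇒≢ x~m ∷ x≢y ∷ x≢z ∷ []) ∷ (adj⇒≢ m~y ∷ m≢z ∷ []) ∷ (y≢z ∷ []) ∷ [] ∷ [])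
      (x~m ∷ m~y ∷ y~z ∷ [-]) z~x
    closes-cycle (_ , inj₂ (p , z~p , p~x)) (_ , inj₁ y~z) = girth⇒no-short-cycle girth (x ∷ m ∷ y ∷ z ∷ p ∷ [])
      ((adj⇒≢ x~m ∷ x≢y ∷ x≢z ∷ ≢-sym (adj⇒≢ p~x) ∷ []) ∷ (adj⇒≢ m~y ∷ m≢z ∷ m≢nbr-z (adj-sym z~p) ∷ []) ∷
       (y≢z ∷ y≢nbr-x p~x ∷ []) ∷ (adj⇒≢ z~p ∷ []) ∷ [] ∷ [])
      (x~m ∷ m~y ∷ y~z ∷ z~p ∷ [-]) p~x
    closes-cycle (_ , inj₁ z~x) (_ , inj₂ (q , y~q , q~z)) = girth⇒no-short-cycle girth (x ∷ m ∷ y ∷ q ∷ z ∷ [])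
      ((adj⇒≢ x~m ∷ x≢y ∷ x≢nbr-y y~q ∷ x≢z ∷ []) ∷ (adj⇒≢ m~y ∷ m≢nbr-z q~z ∷ m≢z ∷ []) ∷
       (adj⇒≢ y~q ∷ y≢z ∷ []) ∷ (adj⇒≢ q~z ∷ []) ∷ [] ∷ [])
      (x~m ∷ m~y ∷ y~q ∷ q~z ∷ [-]) z~x
    closes-cycle (_ , inj₂ (p , z~p , p~x)) (_ , inj₂ (q , y~q , q~z)) with p ≟ q
    ... | yes refl = girth⇒no-short-cycle girth (x ∷ m ∷ y ∷ p ∷ [])
      ((adj⇒≢ x~m ∷ x≢y ∷ x≢nbr-y y~q ∷ []) ∷ (adj⇒≢ m~y ∷ m≢nbr-z q~z ∷ []) ∷ (adj⇒≢ y~q ∷ []) ∷ [] ∷ [])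
      (x~m ∷ m~y ∷ y~q ∷ [-]) p~x
    ... | no p≢q = girth⇒no-short-cycle girth (x ∷ m ∷ y ∷ q ∷ z ∷ p ∷ [])
      ((adj⇒≢ x~m ∷ x≢y ∷ x≢nbr-y y~q ∷ x≢z ∷ ≢-sym (adj⇒≢ p~x) ∷ []) ∷
       (adj⇒≢ m~y ∷ m≢nbr-z q~z ∷ m≢z ∷ m≢nbr-z (adj-sym z~p) ∷ []) ∷
       (adj⇒≢ y~q ∷ y≢z ∷ y≢nbr-x p~x ∷ []) ∷ (adj⇒≢ q~z ∷ ≢-sym p≢q ∷ []) ∷ (adj⇒≢ z~p ∷ []) ∷ [] ∷ [])
      (x~m ∷ m~y ∷ y~q ∷ q~z ∷ z~p ∷ [-]) p~x

  clique⊆N[middle] : GirthAtLeast H 7 → ∀ {Q x m y} → IsClique G Q → x ∈ Q → y ∈ Q →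
                     y ∉ N[ H , x ] → Adj H x m → Adj H m y → Q ⊆ N[ H , m ]
  clique⊆N[middle] girth {Q} {x} {m} {y} clique x∈Q y∈Q y∉N[x] x~m m~y {z} z∈Q with z ∈? N[ H , m ]
  ... | yes z∈N[m] = z∈N[m]
  ... | no z∉N[m] = ⊥-elim (¬adj²-to-both-ends girth y∉N[x] x~m m~y z∉N[m]
                             (clique z x z∈Q x∈Q z≢x) (clique y z y∈Q z∈Q y≢z))
    where
    z≢x : z ≢ x
    z≢x refl = ∉N[]⇒¬adj z∉N[m] (adj-sym x~m)
    y≢z : y ≢ z
    y≢z refl = ∉N[]⇒¬adj z∉N[m] m~y

  clique⊆N[] : GirthAtLeast H 7 → ∀ {Q x} → IsClique G Q → x ∈ Q → ∃ λ v → Q ⊆ N[ H , v ]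
  clique⊆N[] girth {Q} {x} clique x∈Q with any? (λ y → y ∈? Q ×-dec ¬? (y ∈? N[ H , x ]))
  ... | no none = x , Q⊆N[x]
    where
    Q⊆N[x] : Q ⊆ N[ H , x ]
    Q⊆N[x] {y} y∈Q with y ∈? N[ H , x ]
    ... | yes y∈N[x] = y∈N[x]
    ... | no y∉N[x] = contradiction (y , y∈Q , y∉N[x]) none
  ... | yes (y , y∈Q , y∉N[x]) with clique x y x∈Q y∈Q (≢-sym (∉N[]⇒≢ y∉N[x]))
  ...   | _ , inj₁ x~y = contradiction x~y (∉N[]⇒¬adj y∉N[x])
  ...   | _ , inj₂ (m , x~m , m~y) = m , clique⊆N[middle] girth clique x∈Q y∈Q y∉N[x] x~m m~y

  closed-set-everywhere : Connected G → (P : Fin n → Set) → (∀ {u w} → P u → Adj H u w → P w) →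
                          ∀ {v} → P v → ∀ w → P w
  closed-set-everywhere connected P closed {v} Pv w = along (connected v w) Pv
    where
    along : ∀ {u w} → Walk G u w → P u → P w
    along [] Pu = Pu
    along ((_ , inj₁ u~t) ∷ walk) Pu = along walk (closed Pu u~t)
    along ((_ , inj₂ (_ , u~s , s~t)) ∷ walk) Pu = along walk (closed (closed Pu u~s) s~t)

  isolated⇒complete : Connected G → ∀ {v} → (∀ u → ¬ Adj H v u) → Complete G
  isolated⇒complete connected {v} isolated a b a≢b = contradiction (trans (is-v a) (sym (is-v b))) a≢b
    where
    is-v : ∀ w → w ≡ v
    is-v = closed-set-everywhere connected (_≡ v) (λ { refl v~w → ⊥-elim (isolated _ v~w) }) refl

  leaf-edge⇒complete : Connected G → ∀ {u v} → Adj H u v → ¬ 2 ≤ deg H u → ¬ 2 ≤ deg H v → Complete G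
  leaf-edge⇒complete connected {u} {v} u~v deg-u<2 deg-v<2 a b a≢b = adjacent a≢b (on-edge a) (on-edge b)
    where
    closed : ∀ {s t} → s ≡ u ⊎ s ≡ v → Adj H s t → t ≡ u ⊎ t ≡ v
    closed (inj₁ refl) u~t = inj₂ (deg<2⇒neighbour-unique deg-u<2 u~t u~v)
    closed (inj₂ refl) v~t = inj₁ (deg<2⇒neighbour-unique deg-v<2 v~t (adj-sym u~v))
    on-edge : ∀ w → w ≡ u ⊎ w ≡ v
    on-edge = closed-set-everywhere connected _ closed (inj₁ refl)
    adjacent : ∀ {s t} → s ≢ t → s ≡ u ⊎ s ≡ v → t ≡ u ⊎ t ≡ v → Adj² H s t
    adjacent s≢t (inj₁ refl) (inj₁ refl) = contradiction refl s≢t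
    adjacent s≢t (inj₁ refl) (inj₂ refl) = s≢t , inj₁ u~v
    adjacent s≢t (inj₂ refl) (inj₁ refl) = s≢t , inj₁ (adj-sym u~v)
    adjacent s≢t (inj₂ refl) (inj₂ refl) = contradiction refl s≢t

  N[]⊆N[]-of-degree≥2 : Connected G → ¬ Complete G → ∀ v → ∃ λ w → 2 ≤ deg H w × N[ H , v ] ⊆ N[ H , w ]
  N[]⊆N[]-of-degree≥2 connected incomplete v with 2 ≤? deg H v
  ... | yes 2≤deg = v , 2≤deg , (λ w∈ → w∈)
  ... | no deg<2 with any? (adj? H v)
  ...   | no isolated = ⊥-elim (incomplete (isolated⇒complete connected (λ u v~u → isolated (u , v~u))))
  ...   | yes (u , v~u) with 2 ≤? deg H u
  ...     | no deg-u<2 = ⊥-elim (incomplete (leaf-edge⇒complete connected v~u deg<2 deg-u<2))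
  ...     | yes 2≤deg-u = u , 2≤deg-u , N[v]⊆N[u]
    where
    N[v]⊆N[u] : N[ H , v ] ⊆ N[ H , u ]
    N[v]⊆N[u] w∈N[v] with ∈N[]⁻ w∈N[v]
    ... | inj₁ refl = ∈N[]⁺ (inj₂ (adj-sym v~u))
    ... | inj₂ v~w = ∈N[]⁺ (inj₁ (deg<2⇒neighbour-unique deg<2 v~w v~u))

proposition2p1 : ∀ {n : ℕ} (H : Graph n) →
    Connected (square H) → ¬ Complete (square H) →
    ((GirthAtLeast H 6 → ∀ (v : Fin n) → 2 ≤ deg H v →
        IsMaximalClique (square H) N[ H , v ])
    × (GirthAtLeast H 7 → ∀ (Q : Subset n) → IsMaximalClique (square H) Q →
        Σ (Fin n) (λ v → 2 ≤ deg H v × Q ≡ N[ H , v ])))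
proposition2p1 H connected incomplete = N[]-isMaximalClique H , maximal-clique-is-N[]
  where
  maximal-clique-is-N[] : GirthAtLeast H 7 → ∀ Q → IsMaximalClique (square H) Q →
                          Σ (Fin _) (λ v → 2 ≤ deg H v × Q ≡ N[ H , v ])
  maximal-clique-is-N[] girth Q maximal
    with x , x∈Q ← maximal-clique-nonempty (square H) maximal (¬Complete⇒vertex (square H) incomplete)
    with v , Q⊆N[v] ← clique⊆N[] H girth (proj₁ maximal) x∈Q
    with w , 2≤deg , N[v]⊆N[w] ← N[]⊆N[]-of-degree≥2 H connected incomplete v
    = w , 2≤deg , maximal⊆clique⇒≡ (square H) maximal (N[]-isClique H w) (N[v]⊆N[w] ∘ Q⊆N[v])
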